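{- Let $T$ be a finite tree containing a path $v_0,v_1,v_2,v_3$ of distinct nodes with $\deg(v_0)=1$ and $\deg(v_1)=\deg(v_2)=2$. Let $T^0=T\setminus v_0$ and $T^1=T^0\setminus v_1$, and let $\mathcal{M}\in\{\mathcal{MIN},\mathcal{MAJ}\}$. Then $|\mathcal{F}_{\mathcal{M}}(T)|=|\mathcal{F}_{\mathcal{M}}(T^0)|+|\mathcal{F}_{\mathcal{M}}(T^1)|$.
   Context: Colorings are maps $c:V\to\{0,1\}$; $N^i(v)$ is the set of neighbors of $v$ with color $i$. $\mathcal{MIN}(c)(v)=c(v)$ if $|N^{c(v)}(v)|\le|N^{1-c(v)}(v)|$, else $1-c(v)$; $\mathcal{MAJ}(c)(v)=c(v)$ if $|N^{c(v)}(v)|\ge|N^{1-c(v)}(v)|$, else $1-c(v)$. $\mathcal{F}_{\mathcal{M}}(T)$ is the set of colorings $c$ of $T$ with $\mathcal{M}(c)=c$. $T\setminus v$ denotes the tree obtained by deleting node $v$ (a leaf) and its incident edge. -}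

module Defs where

open import Data.Bool using (Bool; true; false; _∧_; not; if_then_else_)
open import Data.Bool.Properties using () renaming (_≟_ to _≟ᵇ_)
open import Data.Nat using (ℕ; zero; suc; _≤_; _≤ᵇ_)
open import Data.Fin using (Fin; zero; suc; punchIn)
open import Data.Fin.Properties using (punchIn-injective)
open import Data.List using (List; []; _∷_; length; filterᵇ; concatMap; map; allFin; [_])
open import Data.List.Relation.Unary.Unique.Propositional using (Unique)
open import Data.Product using (Σ; ∃; _×_; _,_)
open import Data.Empty using (⊥)
open import Data.Unit using (⊤)
open import Relation.Nullary using (¬_)
open import Relation.Binary.PropositionalEquality using (_≡_)

record Graph (n : ℕ) : Set where
  field
    adj     : Fin n → Fin n → Bool
    sym     : ∀ u v → adj u v ≡ adj v u
    irrefl  : ∀ v → adj v v ≡ false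
open Graph public

countᵇ : {n : ℕ} → (Fin n → Bool) → ℕ
countᵇ {n} p = length (filterᵇ p (allFin n))

Adj : {n : ℕ} → Graph n → Fin n → Fin n → Set
Adj G u v = adj G u v ≡ true

deg : {n : ℕ} → Graph n → Fin n → ℕ
deg G v = countᵇ (adj G v)

data Walk {n : ℕ} (G : Graph n) : Fin n → Fin n → Set where
  here : ∀ {u} → Walk G u u
  step : ∀ {u w v} → Adj G u w → Walk G w v → Walk G u v

Connected : {n : ℕ} → Graph n → Set
Connected G = ∀ u v → Walk G u v

Chain : {n : ℕ} → Graph n → List (Fin n) → Set
Chain G []           = ⊤
Chain G (x ∷ [])     = ⊤
Chain G (x ∷ y ∷ xs) = Adj G x y × Chain G (y ∷ xs)

IsCycle : {n : ℕ} → Graph n → List (Fin n) → Set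
IsCycle G []       = ⊥
IsCycle G (x ∷ xs) = (3 ≤ length (x ∷ xs)) × Unique (x ∷ xs) × Chain G (x ∷ xs)
                     × Adj G (lastFrom x xs) x
  where
  lastFrom : Fin _ → List (Fin _) → Fin _
  lastFrom y []       = y
  lastFrom y (z ∷ zs) = lastFrom z zs

Acyclic : {n : ℕ} → Graph n → Set
Acyclic G = ∀ xs → ¬ IsCycle G xs

IsTree : {n : ℕ} → Graph n → Set
IsTree G = Connected G × Acyclic G

-- G \ v : delete vertex v (and its incident edges); remaining vertices
-- are relabelled order-preservingly via punchIn v.
deleteVertex : {n : ℕ} → Graph (suc n) → Fin (suc n) → Graph n
deleteVertex G v = record
  { adj    = λ a b → adj G (punchIn v a) (punchIn v b)
  ; sym    = λ a b → sym G (punchIn v a) (punchIn v b)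
  ; irrefl = λ a → irrefl G (punchIn v a)
  }

-- Colorings c : V → {0,1}, with 0 = false, 1 = true.
Coloring : ℕ → Set
Coloring n = Fin n → Bool

_==_ : Bool → Bool → Bool
true  == b = b
false == b = not b

nbrCount : {n : ℕ} → Graph n → Coloring n → Fin n → Bool → ℕ
nbrCount G c v i = countᵇ (λ u → adj G v u ∧ (c u == i))

data Rule : Set where
  MIN MAJ : Rule

step𝓜 : Rule → {n : ℕ} → Graph n → Coloring n → Coloring n
step𝓜 MIN G c v =
  if nbrCount G c v (c v) ≤ᵇ nbrCount G c v (not (c v)) then c v else not (c v)
step𝓜 MAJ G c v =
  if nbrCount G c v (not (c v)) ≤ᵇ nbrCount G c v (c v) then c v else not (c v)

isFixedᵇ : Rule → {n : ℕ} → Graph n → Coloring n → Bool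
isFixedᵇ M {n} G c = go (allFin n)
  where
  go : List (Fin n) → Bool
  go []       = true
  go (v ∷ vs) = (step𝓜 M G c v == c v) ∧ go vs

consC : {n : ℕ} → Bool → Coloring n → Coloring (suc n)
consC b c zero    = b
consC b c (suc i) = c i

allColorings : (n : ℕ) → List (Coloring n)
allColorings zero    = [ (λ ()) ]
allColorings (suc n) = concatMap (λ b → map (consC b) (allColorings n)) (true ∷ false ∷ [])

numFixed : Rule → {n : ℕ} → Graph n → ℕ
numFixed M {n} G = length (filterᵇ (isFixedᵇ M G) (allColorings n))

{-# OPTIONS --safe #-}
module Submission where

-- Split every colouring of T by the colours x, y of v₀, v₁. All neighbours of v₀, v₁ and v₂ lie
-- on the path v₀ v₁ v₂ v₃, so a colouring of T, T⁰ or T¹ is fixed exactly when the path vertices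
-- present are stable, which depends only on the colours along the path, and every other vertex is
-- stable, which is the same condition in all three trees. Summing over x and y, the theorem thus
-- reduces, for each colouring of T¹, to an identity between Boolean conditions on the colours of
-- v₂ and v₃, which is checked case by case for both rules.

open import Defs hiding (sym)
import Algebra.Properties.CommutativeMonoid.Sum as MonoidSum
open import Data.Bool using (Bool; true; false; _∧_; not; if_then_else_)
open import Data.Bool.Properties using (∧-commutativeMonoid; T?)
open import Data.Empty using (⊥; ⊥-elim)
open import Data.Fin using (Fin; zero; suc; punchIn; punchOut)
open import Data.Fin.Properties
  using (punchInᵢ≢i; punchIn-injective; punchIn-punchOut; punchOut-cong; punchOut-punchIn)
open import Data.List using (List; []; _∷_; [_]; _++_; length; filterᵇ; map; foldr; tabulate; allFin)
open import Data.List.Properties using (filter-++; length-++; ++-identityʳ)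
open import Data.Nat using (ℕ; zero; suc; _+_; _≤ᵇ_)
open import Data.Nat.ListAction using (sum)
open import Data.Nat.Properties
  using (+-0-commutativeMonoid; +-commutativeSemigroup; suc-injective; m+n≡0⇒m≡0)
open import Algebra.Properties.CommutativeSemigroup +-commutativeSemigroup using (interchange)
open import Data.Vec.Functional using (insertAt; removeAt)
open import Data.Vec.Functional.Properties using (insertAt-lookup; insertAt-punchIn)
open import Function using (_∘_; id)
open import Relation.Nullary using (¬_)
open import Relation.Binary.PropositionalEquality
  using (_≡_; _≢_; _≗_; refl; sym; trans; cong; cong₂; subst; ≢-sym; module ≡-Reasoning)
open ≡-Reasoning

-- Counting Boolean predicates on Fin n

toℕ : Bool → ℕ
toℕ false = 0
toℕ true  = 1

toℕ≡0⇒false : ∀ {b} → toℕ b ≡ 0 → b ≡ false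
toℕ≡0⇒false {false} _ = refl

module ℕ-Sum = MonoidSum +-0-commutativeMonoid
module ∧-Sum = MonoidSum ∧-commutativeMonoid

count : ∀ {n} → (Fin n → Bool) → ℕ
count p = ℕ-Sum.sum (toℕ ∘ p)

all : ∀ {n} → (Fin n → Bool) → Bool
all = ∧-Sum.sum

count-remove : ∀ {n} (p : Fin (suc n) → Bool) a → count p ≡ toℕ (p a) + count (removeAt p a)
count-remove p a = ℕ-Sum.sum-remove {i = a} (toℕ ∘ p)

count-remove-true : ∀ {n} (p : Fin (suc n) → Bool) {a} → p a ≡ true →
                    count p ≡ suc (count (removeAt p a))
count-remove-true p {a} pa = trans (count-remove p a) (cong (λ b → toℕ b + count (removeAt p a)) pa)

count≡0⇒false : ∀ {n} (p : Fin n → Bool) → count p ≡ 0 → ∀ i → p i ≡ false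
count≡0⇒false {suc n} p count≡0 i =
  toℕ≡0⇒false (m+n≡0⇒m≡0 (toℕ (p i)) (trans (sym (count-remove p i)) count≡0))

count-false : ∀ {n} (p : Fin n → Bool) → (∀ i → p i ≡ false) → count p ≡ 0
count-false {n} p p≡false = trans (ℕ-Sum.sum-cong-≗ (cong toℕ ∘ p≡false)) (ℕ-Sum.sum-replicate-zero n)

all-remove : ∀ {n} (p : Fin (suc n) → Bool) a → all p ≡ p a ∧ all (removeAt p a)
all-remove p a = ∧-Sum.sum-remove {i = a} p

data Punched {n} (i : Fin (suc n)) : Fin (suc n) → Set where
  punched : (j : Fin n) → Punched i (punchIn i j)

punch : ∀ {n} {i j : Fin (suc n)} → j ≢ i → Punched i j
punch j≢i = subst (Punched _) (punchIn-punchOut (≢-sym j≢i)) (punched _)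

punchIn-≢ : ∀ {n} (i : Fin (suc n)) {j k : Fin n} → j ≢ k → punchIn i j ≢ punchIn i k
punchIn-≢ i j≢k = j≢k ∘ punchIn-injective i _ _

count≡1⇒false : ∀ {n} {p : Fin (suc n) → Bool} {a w} →
                count p ≡ 1 → p a ≡ true → w ≢ a → p w ≡ false
count≡1⇒false {p = p} count≡1 pa w≢a with punch w≢a
... | punched w =
  count≡0⇒false (removeAt p _) (suc-injective (trans (sym (count-remove-true p pa)) count≡1)) w

count≡2⇒false : ∀ {n} {p : Fin (2 + n) → Bool} {a b w} →
                count p ≡ 2 → p a ≡ true → p b ≡ true → b ≢ a → w ≢ a → w ≢ b → p w ≡ false
count≡2⇒false {p = p} {a} count≡2 pa pb b≢a w≢a w≢b with punch b≢a | punch w≢a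
... | punched b | punched w with punch {i = b} {j = w} (w≢b ∘ cong (punchIn a))
...   | punched w′ = count≡0⇒false (removeAt (removeAt p a) b) rest≡0 w′
  where
  count≡2+rest : count p ≡ 2 + count (removeAt (removeAt p a) b)
  count≡2+rest = trans (count-remove-true p pa) (cong suc (count-remove-true (removeAt p a) pb))
  rest≡0 : count (removeAt (removeAt p a) b) ≡ 0
  rest≡0 = suc-injective (suc-injective (trans (sym count≡2+rest) count≡2))

length-filterᵇ-tabulate : ∀ {A : Set} {n} (p : A → Bool) (g : Fin n → A) →
                          length (filterᵇ p (tabulate g)) ≡ count (p ∘ g)
length-filterᵇ-tabulate {n = zero}  p g = refl
length-filterᵇ-tabulate {n = suc n} p g with p (g zero)
... | true  = cong suc (length-filterᵇ-tabulate p (g ∘ suc))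
... | false = length-filterᵇ-tabulate p (g ∘ suc)

countᵇ≡count : ∀ {n} (p : Fin n → Bool) → countᵇ p ≡ count p
countᵇ≡count p = length-filterᵇ-tabulate p id

-- Neighbourhoods

Adj-sym : ∀ {n} (G : Graph n) {u w} → Adj G u w → Adj G w u
Adj-sym G {u} {w} uw = trans (Graph.sym G w u) uw

deg≡count : ∀ {n} (G : Graph n) u → deg G u ≡ count (adj G u)
deg≡count G u = countᵇ≡count (adj G u)

nbrCount≡count : ∀ {n} (G : Graph n) c u i →
                 nbrCount G c u i ≡ count (λ w → adj G u w ∧ (c w == i))
nbrCount≡count G c u i = countᵇ≡count (λ w → adj G u w ∧ (c w == i))

colourCount : List Bool → Bool → ℕ
colourCount bs i = sum (map (λ b → toℕ (b == i)) bs)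

nbrCount-one : ∀ {n} {G : Graph (suc n)} {u a} → Adj G u a → (∀ {w} → w ≢ a → adj G u w ≡ false) →
               ∀ c i → nbrCount G c u i ≡ colourCount [ c a ] i
nbrCount-one {n} {G} {u} {a} ua only c i = begin
  nbrCount G c u i                                        ≡⟨ nbrCount≡count G c u i ⟩
  count nbr                                               ≡⟨ count-remove nbr a ⟩
  toℕ (adj G u a ∧ (c a == i)) + count (removeAt nbr a)
    ≡⟨ cong₂ (λ b k → toℕ (b ∧ (c a == i)) + k) ua
             (count-false (removeAt nbr a) (λ w → cong (_∧ _) (only (punchInᵢ≢i a w)))) ⟩
  colourCount [ c a ] i                                   ∎
  where
  nbr : Fin (suc n) → Bool
  nbr w = adj G u w ∧ (c w == i)

nbrCount-two : ∀ {n} {G : Graph (2 + n)} {u a b} → Adj G u a → Adj G u b → b ≢ a →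
               (∀ {w} → w ≢ a → w ≢ b → adj G u w ≡ false) →
               ∀ c i → nbrCount G c u i ≡ colourCount (c a ∷ c b ∷ []) i
nbrCount-two {n} {G} {u} {a} ua ub b≢a only c i with punch b≢a
... | punched b = begin
  nbrCount G c u i
    ≡⟨ nbrCount≡count G c u i ⟩
  count nbr
    ≡⟨ trans (count-remove nbr a) (cong (toℕ (nbr a) +_) (count-remove (removeAt nbr a) b)) ⟩
  toℕ (nbr a) + (toℕ (nbr (punchIn a b)) + count rest)
    ≡⟨ cong₂ (λ x y → toℕ (x ∧ _) + (toℕ (y ∧ _) + count rest)) ua ub ⟩
  toℕ (c a == i) + (toℕ (c (punchIn a b) == i) + count rest)
    ≡⟨ cong (λ k → toℕ (c a == i) + (toℕ (c (punchIn a b) == i) + k)) (count-false rest rest≡false) ⟩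
  colourCount (c a ∷ c (punchIn a b) ∷ []) i
    ∎
  where
  nbr : Fin (2 + n) → Bool
  nbr w = adj G u w ∧ (c w == i)
  rest : Fin n → Bool
  rest = removeAt (removeAt nbr a) b
  rest≡false : ∀ w → rest w ≡ false
  rest≡false w = cong (_∧ _) (only (punchInᵢ≢i a _) (punchIn-≢ a (punchInᵢ≢i b w)))

-- Stability of a vertex

isStableᵇ : Rule → ∀ {n} → Graph n → Coloring n → Fin n → Bool
isStableᵇ M G c u = step𝓜 M G c u == c u

stableᵇ : Rule → (colour : Bool) (same other : ℕ) → Bool
stableᵇ MIN b same other = (if same ≤ᵇ other then b else not b) == b
stableᵇ MAJ b same other = (if other ≤ᵇ same then b else not b) == b

stableAmong : Rule → Bool → List Bool → Bool
stableAmong M b bs = stableᵇ M b (colourCount bs b) (colourCount bs (not b))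

isStableᵇ-unfold : ∀ M {n} (G : Graph n) c u →
                   isStableᵇ M G c u ≡ stableᵇ M (c u) (nbrCount G c u (c u)) (nbrCount G c u (not (c u)))
isStableᵇ-unfold MIN G c u = refl
isStableᵇ-unfold MAJ G c u = refl

isStableᵇ-profile : ∀ M {n} {G : Graph n} {c u} (g : Bool → ℕ) → (∀ i → nbrCount G c u i ≡ g i) →
                    isStableᵇ M G c u ≡ stableᵇ M (c u) (g (c u)) (g (not (c u)))
isStableᵇ-profile M {G = G} {c} {u} g nbr≡g =
  trans (isStableᵇ-unfold M G c u) (cong₂ (stableᵇ M (c u)) (nbr≡g (c u)) (nbr≡g (not (c u))))

isStableᵇ-cong : ∀ M {n k} {G : Graph n} {H : Graph k} {c d u w} →
                 (∀ i → nbrCount G c u i ≡ nbrCount H d w i) → c u ≡ d w →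
                 isStableᵇ M G c u ≡ isStableᵇ M H d w
isStableᵇ-cong M {H = H} {d = d} {w = w} nbr≡ colour≡ =
  trans (isStableᵇ-profile M (nbrCount H d w) nbr≡)
        (trans (cong (λ b → stableᵇ M b (nbrCount H d w b) (nbrCount H d w (not b))) colour≡)
               (sym (isStableᵇ-unfold M H d w)))

isStableᵇ-one : ∀ M {n} {G : Graph (suc n)} {u a} → Adj G u a → (∀ {w} → w ≢ a → adj G u w ≡ false) →
                ∀ {c x y} → c u ≡ x → c a ≡ y → isStableᵇ M G c u ≡ stableAmong M x [ y ]
isStableᵇ-one M {G = G} {u} {a} ua only {c} refl refl =
  isStableᵇ-profile M (colourCount [ c a ]) (nbrCount-one {G = G} {u} ua only c)

isStableᵇ-two : ∀ M {n} {G : Graph (2 + n)} {u a b} → Adj G u a → Adj G u b → b ≢ a →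
                (∀ {w} → w ≢ a → w ≢ b → adj G u w ≡ false) →
                ∀ {c x y z} → c u ≡ x → c a ≡ y → c b ≡ z →
                isStableᵇ M G c u ≡ stableAmong M x (y ∷ z ∷ [])
isStableᵇ-two M {G = G} {u} {a} {b} ua ub b≢a only {c} refl refl refl =
  isStableᵇ-profile M (colourCount (c a ∷ c b ∷ [])) (nbrCount-two {G = G} {u} ua ub b≢a only c)

isStableᵇ-insertAt : ∀ M {n} (G : Graph (suc n)) v x (d : Coloring n) u →
                     adj G (punchIn v u) v ≡ false →
                     isStableᵇ M G (insertAt d v x) (punchIn v u) ≡ isStableᵇ M (deleteVertex G v) d u
isStableᵇ-insertAt M G v x d u u≁v = isStableᵇ-cong M nbrCount≡ (insertAt-punchIn d v x u)
  where
  c : Coloring _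
  c = insertAt d v x
  nbrCount≡ : ∀ i → nbrCount G c (punchIn v u) i ≡ nbrCount (deleteVertex G v) d u i
  nbrCount≡ i = begin
    nbrCount G c (punchIn v u) i
      ≡⟨ nbrCount≡count G c (punchIn v u) i ⟩
    count (λ w → adj G (punchIn v u) w ∧ (c w == i))
      ≡⟨ count-remove (λ w → adj G (punchIn v u) w ∧ (c w == i)) v ⟩
    toℕ (adj G (punchIn v u) v ∧ (c v == i))
      + count (λ w → adj G (punchIn v u) (punchIn v w) ∧ (c (punchIn v w) == i))
      ≡⟨ cong₂ (λ b k → toℕ (b ∧ (c v == i)) + k) u≁v
               (ℕ-Sum.sum-cong-≗ (λ w → cong (λ b → toℕ (adj G (punchIn v u) (punchIn v w) ∧ (b == i)))
                                              (insertAt-punchIn d v x w))) ⟩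
    count (λ w → adj (deleteVertex G v) u w ∧ (d w == i))
      ≡⟨ sym (nbrCount≡count (deleteVertex G v) d u i) ⟩
    nbrCount (deleteVertex G v) d u i
      ∎

-- Defs defines isFixedᵇ as a fold along allFin n with a where-bound function that cannot be named
-- here; abstracting over allFin n lets the F below be solved to that function.
foldr-∧-unique : ∀ {A : Set} {F : List A → Bool} (f : A → Bool) → F [] ≡ true →
                 (∀ x xs → F (x ∷ xs) ≡ (f x ∧ F xs)) → ∀ xs → F xs ≡ foldr (λ x b → f x ∧ b) true xs
foldr-∧-unique         f nil cons []       = nil
foldr-∧-unique {F = F} f nil cons (x ∷ xs) =
  trans (cons x xs) (cong (f x ∧_) (foldr-∧-unique {F = F} f nil cons xs))

foldr-∧-tabulate : ∀ {A : Set} {n} (f : A → Bool) (g : Fin n → A) →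
                   foldr (λ x b → f x ∧ b) true (tabulate g) ≡ all (f ∘ g)
foldr-∧-tabulate {n = zero}  f g = refl
foldr-∧-tabulate {n = suc n} f g = cong (f (g zero) ∧_) (foldr-∧-tabulate f (g ∘ suc))

isFixedᵇ≡all : ∀ M {n} (G : Graph n) c → isFixedᵇ M G c ≡ all (isStableᵇ M G c)
isFixedᵇ≡all M {n} G c = trans isFixedᵇ≡foldr (foldr-∧-tabulate (isStableᵇ M G c) id)
  where
  isFixedᵇ≡foldr : isFixedᵇ M G c ≡ foldr (λ u b → isStableᵇ M G c u ∧ b) true (allFin n)
  isFixedᵇ≡foldr with foldr-∧-unique {F = _} (isStableᵇ M G c) refl (λ _ _ → refl) | allFin n
  ... | unique | us = unique us

isFixedᵇ-cong : ∀ M {n} (G : Graph n) {c c′} → c ≗ c′ → isFixedᵇ M G c ≡ isFixedᵇ M G c′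
isFixedᵇ-cong M G {c} {c′} c≗c′ = begin
  isFixedᵇ M G c          ≡⟨ isFixedᵇ≡all M G c ⟩
  all (isStableᵇ M G c)   ≡⟨ ∧-Sum.sum-cong-≗ (λ u → isStableᵇ-cong M (nbrCount-cong u) (c≗c′ u)) ⟩
  all (isStableᵇ M G c′)  ≡⟨ sym (isFixedᵇ≡all M G c′) ⟩
  isFixedᵇ M G c′         ∎
  where
  nbrCount-cong : ∀ u i → nbrCount G c u i ≡ nbrCount G c′ u i
  nbrCount-cong u i = begin
    nbrCount G c u i
      ≡⟨ nbrCount≡count G c u i ⟩
    count (λ w → adj G u w ∧ (c w == i))
      ≡⟨ ℕ-Sum.sum-cong-≗ (λ w → cong (λ b → toℕ (adj G u w ∧ (b == i))) (c≗c′ w)) ⟩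
    count (λ w → adj G u w ∧ (c′ w == i))
      ≡⟨ sym (nbrCount≡count G c′ u i) ⟩
    nbrCount G c′ u i
      ∎

-- Sums over all colourings

∑ᶜ : ∀ n → (Coloring n → ℕ) → ℕ
∑ᶜ zero    f = f (λ ())
∑ᶜ (suc n) f = ∑ᶜ n (f ∘ consC true) + ∑ᶜ n (f ∘ consC false)

∑ᶜ-cong : ∀ n {f g : Coloring n → ℕ} → (∀ c → f c ≡ g c) → ∑ᶜ n f ≡ ∑ᶜ n g
∑ᶜ-cong zero    f≡g = f≡g _
∑ᶜ-cong (suc n) f≡g = cong₂ _+_ (∑ᶜ-cong n (f≡g ∘ consC true)) (∑ᶜ-cong n (f≡g ∘ consC false))

∑ᶜ-distrib-+ : ∀ n (f g : Coloring n → ℕ) → ∑ᶜ n (λ c → f c + g c) ≡ ∑ᶜ n f + ∑ᶜ n g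
∑ᶜ-distrib-+ zero    f g = refl
∑ᶜ-distrib-+ (suc n) f g =
  trans (cong₂ _+_ (∑ᶜ-distrib-+ n (f ∘ consC true) (g ∘ consC true))
                   (∑ᶜ-distrib-+ n (f ∘ consC false) (g ∘ consC false)))
        (interchange (∑ᶜ n (f ∘ consC true)) (∑ᶜ n (g ∘ consC true))
                     (∑ᶜ n (f ∘ consC false)) (∑ᶜ n (g ∘ consC false)))

length-filterᵇ-++ : ∀ {A : Set} (P : A → Bool) xs ys →
                    length (filterᵇ P (xs ++ ys)) ≡ length (filterᵇ P xs) + length (filterᵇ P ys)
length-filterᵇ-++ P xs ys = trans (cong length (filter-++ (T? ∘ P) xs ys)) (length-++ (filterᵇ P xs))

length-filterᵇ-map : ∀ {A B : Set} (P : B → Bool) (f : A → B) xs →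
                     length (filterᵇ P (map f xs)) ≡ length (filterᵇ (P ∘ f) xs)
length-filterᵇ-map P f []       = refl
length-filterᵇ-map P f (x ∷ xs) with P (f x)
... | true  = cong suc (length-filterᵇ-map P f xs)
... | false = length-filterᵇ-map P f xs

length-filterᵇ-allColorings : ∀ n (P : Coloring n → Bool) →
                              length (filterᵇ P (allColorings n)) ≡ ∑ᶜ n (toℕ ∘ P)
length-filterᵇ-allColorings zero P = length-filterᵇ-[] (λ ())
  where
  length-filterᵇ-[] : ∀ c → length (filterᵇ P [ c ]) ≡ toℕ (P c)
  length-filterᵇ-[] c with P c
  ... | true  = refl
  ... | false = refl
length-filterᵇ-allColorings (suc n) P = begin
  length (filterᵇ P (map (consC true) cs ++ (map (consC false) cs ++ [])))
    ≡⟨ length-filterᵇ-++ P (map (consC true) cs) _ ⟩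
  length (filterᵇ P (map (consC true) cs)) + length (filterᵇ P (map (consC false) cs ++ []))
    ≡⟨ cong (λ ds → length (filterᵇ P (map (consC true) cs)) + length (filterᵇ P ds))
            (++-identityʳ (map (consC false) cs)) ⟩
  length (filterᵇ P (map (consC true) cs)) + length (filterᵇ P (map (consC false) cs))
    ≡⟨ cong₂ _+_ (length-filterᵇ-map P (consC true) cs) (length-filterᵇ-map P (consC false) cs) ⟩
  length (filterᵇ (P ∘ consC true) cs) + length (filterᵇ (P ∘ consC false) cs)
    ≡⟨ cong₂ _+_ (length-filterᵇ-allColorings n (P ∘ consC true))
                 (length-filterᵇ-allColorings n (P ∘ consC false)) ⟩
  ∑ᶜ (suc n) (toℕ ∘ P)
    ∎
  where
  cs : List (Coloring n)
  cs = allColorings n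

numFixed≡∑ᶜ : ∀ M {n} (G : Graph n) → numFixed M G ≡ ∑ᶜ n (toℕ ∘ isFixedᵇ M G)
numFixed≡∑ᶜ M {n} G = length-filterᵇ-allColorings n (isFixedᵇ M G)

-- Needed because insertAt c zero b agrees with consC b c only pointwise.
Extensional : ∀ {n} → (Coloring n → ℕ) → Set
Extensional f = ∀ {c c′} → c ≗ c′ → f c ≡ f c′

isFixedᵇ-extensional : ∀ M {n} (G : Graph n) → Extensional (toℕ ∘ isFixedᵇ M G)
isFixedᵇ-extensional M G = cong toℕ ∘ isFixedᵇ-cong M G

insertAt-cong : ∀ {n} {c c′ : Coloring n} v x → c ≗ c′ → insertAt c v x ≗ insertAt c′ v x
insertAt-cong         zero    x c≗c′ zero    = refl
insertAt-cong         zero    x c≗c′ (suc j) = c≗c′ j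
insertAt-cong {suc n} (suc v) x c≗c′ zero    = c≗c′ zero
insertAt-cong {suc n} (suc v) x c≗c′ (suc j) = insertAt-cong v x (c≗c′ ∘ suc) j

insertAt-extensional : ∀ {n} {f : Coloring (suc n) → ℕ} → Extensional f → ∀ v →
                       Extensional (λ c → f (insertAt c v true) + f (insertAt c v false))
insertAt-extensional ext v c≗c′ =
  cong₂ _+_ (ext (insertAt-cong v true c≗c′)) (ext (insertAt-cong v false c≗c′))

∑ᶜ-insertAt : ∀ n {f : Coloring (suc n) → ℕ} → Extensional f → ∀ v →
              ∑ᶜ (suc n) f ≡ ∑ᶜ n (λ c → f (insertAt c v true) + f (insertAt c v false))
∑ᶜ-insertAt n {f} ext zero = begin
  ∑ᶜ n (f ∘ consC true) + ∑ᶜ n (f ∘ consC false)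
    ≡⟨ cong₂ _+_ (∑ᶜ-cong n (λ c → ext (consC≗insertAt c true)))
                 (∑ᶜ-cong n (λ c → ext (consC≗insertAt c false))) ⟩
  ∑ᶜ n (λ c → f (insertAt c zero true)) + ∑ᶜ n (λ c → f (insertAt c zero false))
    ≡⟨ sym (∑ᶜ-distrib-+ n _ _) ⟩
  ∑ᶜ n (λ c → f (insertAt c zero true) + f (insertAt c zero false))
    ∎
  where
  consC≗insertAt : ∀ c b → consC b c ≗ insertAt c zero b
  consC≗insertAt c b zero    = refl
  consC≗insertAt c b (suc j) = refl
∑ᶜ-insertAt (suc n) {f} ext (suc v) = begin
  ∑ᶜ (suc n) (f ∘ consC true) + ∑ᶜ (suc n) (f ∘ consC false)
    ≡⟨ cong₂ _+_ (∑ᶜ-insertAt n (ext ∘ consC-cong true) v) (∑ᶜ-insertAt n (ext ∘ consC-cong false) v) ⟩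
  ∑ᶜ n (λ c → f (consC true (insertAt c v true)) + f (consC true (insertAt c v false)))
    + ∑ᶜ n (λ c → f (consC false (insertAt c v true)) + f (consC false (insertAt c v false)))
    ≡⟨ cong₂ _+_ (∑ᶜ-cong n (λ c → cong₂ _+_ (ext (consC-insertAt c true true))
                                              (ext (consC-insertAt c true false))))
                 (∑ᶜ-cong n (λ c → cong₂ _+_ (ext (consC-insertAt c false true))
                                              (ext (consC-insertAt c false false)))) ⟩
  ∑ᶜ (suc n) (λ c → f (insertAt c (suc v) true) + f (insertAt c (suc v) false))
    ∎
  where
  consC-cong : ∀ b {c c′ : Coloring (suc n)} → c ≗ c′ → consC b c ≗ consC b c′
  consC-cong b c≗c′ zero    = refl
  consC-cong b c≗c′ (suc j) = c≗c′ j
  consC-insertAt : ∀ c b x → consC b (insertAt c v x) ≗ insertAt (consC b c) (suc v) x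
  consC-insertAt c b x zero    = refl
  consC-insertAt c b x (suc j) = refl

-- The pendant path

-- The conditions for a colouring of T, T⁰, T¹ to be fixed: x, y, z, w are the colours of
-- v₀, v₁, v₂, v₃ and r says that every vertex off the path v₀ v₁ v₂ is stable.
pathFixed₃ : Rule → (x y z w r : Bool) → Bool
pathFixed₃ M x y z w r =
  stableAmong M x [ y ] ∧ (stableAmong M y (x ∷ z ∷ []) ∧ (stableAmong M z (y ∷ w ∷ []) ∧ r))

pathFixed₂ : Rule → (y z w r : Bool) → Bool
pathFixed₂ M y z w r = stableAmong M y [ z ] ∧ (stableAmong M z (y ∷ w ∷ []) ∧ r)

pathFixed₁ : Rule → (z w r : Bool) → Bool
pathFixed₁ M z w r = stableAmong M z [ w ] ∧ r

pathFixed-count : ∀ M z w r →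
  (toℕ (pathFixed₃ M true true z w r) + toℕ (pathFixed₃ M false true z w r))
    + (toℕ (pathFixed₃ M true false z w r) + toℕ (pathFixed₃ M false false z w r))
  ≡ (toℕ (pathFixed₂ M true z w r) + toℕ (pathFixed₂ M false z w r)) + toℕ (pathFixed₁ M z w r)
pathFixed-count MIN true  true  true  = refl
pathFixed-count MIN true  true  false = refl
pathFixed-count MIN true  false true  = refl
pathFixed-count MIN true  false false = refl
pathFixed-count MIN false true  true  = refl
pathFixed-count MIN false true  false = refl
pathFixed-count MIN false false true  = refl
pathFixed-count MIN false false false = refl
pathFixed-count MAJ true  true  true  = refl
pathFixed-count MAJ true  true  false = refl
pathFixed-count MAJ true  false true  = refl
pathFixed-count MAJ true  false false = refl
pathFixed-count MAJ false true  true  = refl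
pathFixed-count MAJ false true  false = refl
pathFixed-count MAJ false false true  = refl
pathFixed-count MAJ false false false = refl

module PendantPath (M : Rule) {m : ℕ} (T : Graph (3 + m))
                   (v₀ : Fin (3 + m)) (u₁ : Fin (2 + m)) (w₂ w₃ : Fin (1 + m)) where

  T₀ : Graph (2 + m)
  T₀ = deleteVertex T v₀

  T₁ : Graph (1 + m)
  T₁ = deleteVertex T₀ u₁

  u₂ u₃ : Fin (2 + m)
  u₂ = punchIn u₁ w₂
  u₃ = punchIn u₁ w₃

  v₁ v₂ v₃ : Fin (3 + m)
  v₁ = punchIn v₀ u₁
  v₂ = punchIn v₀ u₂
  v₃ = punchIn v₀ u₃

  extend : (x y : Bool) → Coloring (1 + m) → Coloring (3 + m)
  extend x y e = insertAt (insertAt e u₁ y) v₀ x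

  restStable : Coloring (1 + m) → Bool
  restStable e = all (λ z → isStableᵇ M T₁ e (punchIn w₂ z))

  module _ (v₀~v₁ : Adj T v₀ v₁) (v₁~v₂ : Adj T v₁ v₂) (v₂~v₃ : Adj T v₂ v₃)
           (deg-v₀ : deg T v₀ ≡ 1) (deg-v₁ : deg T v₁ ≡ 2) (deg-v₂ : deg T v₂ ≡ 2) where

    v₀-only : ∀ {w} → w ≢ v₁ → adj T v₀ w ≡ false
    v₀-only = count≡1⇒false (trans (sym (deg≡count T v₀)) deg-v₀) v₀~v₁

    v₁-only : ∀ {w} → w ≢ v₀ → w ≢ v₂ → adj T v₁ w ≡ false
    v₁-only = count≡2⇒false (trans (sym (deg≡count T v₁)) deg-v₁) (Adj-sym T v₀~v₁) v₁~v₂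
                            (punchInᵢ≢i v₀ u₂)

    v₂-only : ∀ {w} → w ≢ v₁ → w ≢ v₃ → adj T v₂ w ≡ false
    v₂-only = count≡2⇒false (trans (sym (deg≡count T v₂)) deg-v₂) (Adj-sym T v₁~v₂) v₂~v₃
                            (punchIn-≢ v₀ (punchInᵢ≢i u₁ w₃))

    rest≁v₀ : ∀ z → adj T (punchIn v₀ (punchIn u₁ z)) v₀ ≡ false
    rest≁v₀ z = trans (Graph.sym T _ v₀) (v₀-only (punchIn-≢ v₀ (punchInᵢ≢i u₁ z)))

    rest≁u₁ : ∀ z → adj T₀ (punchIn u₁ (punchIn w₂ z)) u₁ ≡ false
    rest≁u₁ z = trans (Graph.sym T _ v₁)
                      (v₁-only (punchInᵢ≢i v₀ _) (punchIn-≢ v₀ (punchIn-≢ u₁ (punchInᵢ≢i w₂ z))))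

    fixed-T₁ : ∀ e → isFixedᵇ M T₁ e ≡ pathFixed₁ M (e w₂) (e w₃) (restStable e)
    fixed-T₁ e = begin
      isFixedᵇ M T₁ e
        ≡⟨ trans (isFixedᵇ≡all M T₁ e) (all-remove (isStableᵇ M T₁ e) w₂) ⟩
      isStableᵇ M T₁ e w₂ ∧ restStable e
        ≡⟨ cong (_∧ restStable e) (isStableᵇ-one M {G = T₁} v₂~v₃ only refl refl) ⟩
      pathFixed₁ M (e w₂) (e w₃) (restStable e)
        ∎
      where
      only : ∀ {w} → w ≢ w₃ → adj T₁ w₂ w ≡ false
      only w≢w₃ = v₂-only (punchIn-≢ v₀ (punchInᵢ≢i u₁ _)) (punchIn-≢ v₀ (punchIn-≢ u₁ w≢w₃))

    fixed-T₀ : ∀ y e → isFixedᵇ M T₀ (insertAt e u₁ y) ≡ pathFixed₂ M y (e w₂) (e w₃) (restStable e)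
    fixed-T₀ y e = begin
      isFixedᵇ M T₀ d
        ≡⟨ isFixedᵇ≡all M T₀ d ⟩
      all p
        ≡⟨ trans (all-remove p u₁) (cong (p u₁ ∧_) (all-remove (removeAt p u₁) w₂)) ⟩
      p u₁ ∧ (p u₂ ∧ all (λ z → p (punchIn u₁ (punchIn w₂ z))))
        ≡⟨ cong₂ _∧_ at-u₁ (cong₂ _∧_ at-u₂ at-rest) ⟩
      pathFixed₂ M y (e w₂) (e w₃) (restStable e)
        ∎
      where
      d : Coloring (2 + m)
      d = insertAt e u₁ y
      p : Fin (2 + m) → Bool
      p = isStableᵇ M T₀ d
      u₁-only : ∀ {w} → w ≢ u₂ → adj T₀ u₁ w ≡ false
      u₁-only w≢u₂ = v₁-only (punchInᵢ≢i v₀ _) (punchIn-≢ v₀ w≢u₂)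
      u₂-only : ∀ {w} → w ≢ u₁ → w ≢ u₃ → adj T₀ u₂ w ≡ false
      u₂-only w≢u₁ w≢u₃ = v₂-only (punchIn-≢ v₀ w≢u₁) (punchIn-≢ v₀ w≢u₃)
      at-u₁ : p u₁ ≡ stableAmong M y [ e w₂ ]
      at-u₁ = isStableᵇ-one M {G = T₀} v₁~v₂ u₁-only (insertAt-lookup e u₁ y) (insertAt-punchIn e u₁ y w₂)
      at-u₂ : p u₂ ≡ stableAmong M (e w₂) (y ∷ e w₃ ∷ [])
      at-u₂ = isStableᵇ-two M {G = T₀} (Adj-sym T v₁~v₂) v₂~v₃ (punchInᵢ≢i u₁ w₃) u₂-only
                (insertAt-punchIn e u₁ y w₂) (insertAt-lookup e u₁ y) (insertAt-punchIn e u₁ y w₃)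
      at-rest : all (λ z → p (punchIn u₁ (punchIn w₂ z))) ≡ restStable e
      at-rest = ∧-Sum.sum-cong-≗ (λ z → isStableᵇ-insertAt M T₀ u₁ y e _ (rest≁u₁ z))

    fixed-T : ∀ x y e → isFixedᵇ M T (extend x y e) ≡ pathFixed₃ M x y (e w₂) (e w₃) (restStable e)
    fixed-T x y e = begin
      isFixedᵇ M T c
        ≡⟨ isFixedᵇ≡all M T c ⟩
      all p
        ≡⟨ trans (all-remove p v₀) (cong (p v₀ ∧_) (trans (all-remove (removeAt p v₀) u₁)
                 (cong (p v₁ ∧_) (all-remove (removeAt (removeAt p v₀) u₁) w₂)))) ⟩
      p v₀ ∧ (p v₁ ∧ (p v₂ ∧ all (λ z → p (punchIn v₀ (punchIn u₁ (punchIn w₂ z))))))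
        ≡⟨ cong₂ _∧_ at-v₀ (cong₂ _∧_ at-v₁ (cong₂ _∧_ at-v₂ at-rest)) ⟩
      pathFixed₃ M x y (e w₂) (e w₃) (restStable e)
        ∎
      where
      c : Coloring (3 + m)
      c = extend x y e
      p : Fin (3 + m) → Bool
      p = isStableᵇ M T c
      c-v₀ : c v₀ ≡ x
      c-v₀ = insertAt-lookup (insertAt e u₁ y) v₀ x
      c-v₁ : c v₁ ≡ y
      c-v₁ = trans (insertAt-punchIn (insertAt e u₁ y) v₀ x u₁) (insertAt-lookup e u₁ y)
      c-punchIn² : ∀ z → c (punchIn v₀ (punchIn u₁ z)) ≡ e z
      c-punchIn² z = trans (insertAt-punchIn (insertAt e u₁ y) v₀ x _) (insertAt-punchIn e u₁ y z)
      at-v₀ : p v₀ ≡ stableAmong M x [ y ]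
      at-v₀ = isStableᵇ-one M {G = T} v₀~v₁ v₀-only c-v₀ c-v₁
      at-v₁ : p v₁ ≡ stableAmong M y (x ∷ e w₂ ∷ [])
      at-v₁ = isStableᵇ-two M {G = T} (Adj-sym T v₀~v₁) v₁~v₂ (punchInᵢ≢i v₀ u₂) v₁-only
                c-v₁ c-v₀ (c-punchIn² w₂)
      at-v₂ : p v₂ ≡ stableAmong M (e w₂) (y ∷ e w₃ ∷ [])
      at-v₂ = isStableᵇ-two M {G = T} (Adj-sym T v₁~v₂) v₂~v₃ (punchIn-≢ v₀ (punchInᵢ≢i u₁ w₃)) v₂-only
                (c-punchIn² w₂) c-v₁ (c-punchIn² w₃)
      at-rest : all (λ z → p (punchIn v₀ (punchIn u₁ (punchIn w₂ z)))) ≡ restStable e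
      at-rest = ∧-Sum.sum-cong-≗ (λ z → trans (isStableᵇ-insertAt M T v₀ x (insertAt e u₁ y) _ (rest≁v₀ _))
                                              (isStableᵇ-insertAt M T₀ u₁ y e _ (rest≁u₁ z)))

    numFixed-split : numFixed M T ≡ numFixed M T₀ + numFixed M T₁
    numFixed-split = begin
      numFixed M T
        ≡⟨ numFixed≡∑ᶜ M T ⟩
      ∑ᶜ (3 + m) F
        ≡⟨ ∑ᶜ-insertAt (2 + m) (isFixedᵇ-extensional M T) v₀ ⟩
      ∑ᶜ (2 + m) (λ d → F (insertAt d v₀ true) + F (insertAt d v₀ false))
        ≡⟨ ∑ᶜ-insertAt (1 + m) (insertAt-extensional (isFixedᵇ-extensional M T) v₀) u₁ ⟩
      ∑ᶜ (1 + m) (λ e → (F (extend true true e) + F (extend false true e))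
                          + (F (extend true false e) + F (extend false false e)))
        ≡⟨ ∑ᶜ-cong (1 + m) pointwise ⟩
      ∑ᶜ (1 + m) (λ e → F₀² e + F₁ e)
        ≡⟨ ∑ᶜ-distrib-+ (1 + m) F₀² F₁ ⟩
      ∑ᶜ (1 + m) F₀² + ∑ᶜ (1 + m) F₁
        ≡⟨ cong₂ _+_ (sym (trans (numFixed≡∑ᶜ M T₀) (∑ᶜ-insertAt (1 + m) (isFixedᵇ-extensional M T₀) u₁)))
                     (sym (numFixed≡∑ᶜ M T₁)) ⟩
      numFixed M T₀ + numFixed M T₁
        ∎
      where
      F : Coloring (3 + m) → ℕ
      F = toℕ ∘ isFixedᵇ M T
      F₀² : Coloring (1 + m) → ℕ
      F₀² e = toℕ (isFixedᵇ M T₀ (insertAt e u₁ true)) + toℕ (isFixedᵇ M T₀ (insertAt e u₁ false))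
      F₁ : Coloring (1 + m) → ℕ
      F₁ = toℕ ∘ isFixedᵇ M T₁
      pointwise : ∀ e → (F (extend true true e) + F (extend false true e))
                          + (F (extend true false e) + F (extend false false e))
                      ≡ F₀² e + F₁ e
      pointwise e rewrite fixed-T true true e | fixed-T false true e | fixed-T true false e
                        | fixed-T false false e | fixed-T₀ true e | fixed-T₀ false e | fixed-T₁ e
        = pathFixed-count M (e w₂) (e w₃) (restStable e)

no-three-distinct : {a b c : Fin 2} → a ≢ b → a ≢ c → b ≢ c → ⊥
no-three-distinct {zero}     {zero}                 a≢b _   _   = a≢b refl
no-three-distinct {zero}     {suc zero} {zero}      _   a≢c _   = a≢c refl
no-three-distinct {zero}     {suc zero} {suc zero}  _   _   b≢c = b≢c refl
no-three-distinct {suc zero} {zero}     {zero}      _   _   b≢c = b≢c refl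
no-three-distinct {suc zero} {zero}     {suc zero}  _   a≢c _   = a≢c refl
no-three-distinct {suc zero} {suc zero}             a≢b _   _   = a≢b refl

lemma6 : (M : Rule) (n : ℕ) (T : Graph (suc (suc n))) → IsTree T →
           (v₀ v₁ v₂ v₃ : Fin (suc (suc n))) →
           (v₀≢v₁ : ¬ v₀ ≡ v₁) → ¬ v₀ ≡ v₂ → ¬ v₀ ≡ v₃ →
           ¬ v₁ ≡ v₂ → ¬ v₁ ≡ v₃ → ¬ v₂ ≡ v₃ →
           Adj T v₀ v₁ → Adj T v₁ v₂ → Adj T v₂ v₃ →
           deg T v₀ ≡ 1 → deg T v₁ ≡ 2 → deg T v₂ ≡ 2 →
           numFixed M T
             ≡ numFixed M (deleteVertex T v₀)
               + numFixed M (deleteVertex (deleteVertex T v₀) (punchOut v₀≢v₁))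
lemma6 M zero T _ v₀ v₁ v₂ _ v₀≢v₁ v₀≢v₂ _ v₁≢v₂ _ _ _ _ _ _ _ _ =
  ⊥-elim (no-three-distinct v₀≢v₁ v₀≢v₂ v₁≢v₂)
lemma6 M (suc m) T _ v₀ v₁ v₂ v₃ v₀≢v₁ v₀≢v₂ v₀≢v₃ v₁≢v₂ v₁≢v₃ _
       v₀~v₁ v₁~v₂ v₂~v₃ deg-v₀ deg-v₁ deg-v₂
  with punch (≢-sym v₀≢v₁) | punch (≢-sym v₀≢v₂) | punch (≢-sym v₀≢v₃)
... | punched u₁ | punched u₂ | punched u₃
  with punch (≢-sym (v₁≢v₂ ∘ cong (punchIn v₀))) | punch (≢-sym (v₁≢v₃ ∘ cong (punchIn v₀)))
... | punched w₂ | punched w₃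
  rewrite trans (punchOut-cong v₀ {i≢j = v₀≢v₁} refl) (punchOut-punchIn v₀ {u₁})
  = PendantPath.numFixed-split M T v₀ u₁ w₂ w₃ v₀~v₁ v₁~v₂ v₂~v₃ deg-v₀ deg-v₁ deg-v₂
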